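{- For every integer $n \ge 3$, the parity vertex chromatic number of the cycle $C_n$ satisfies $\chi_p(C_n) = \lceil \log_2 n \rceil + 1$.
   Context: All graphs are finite, simple and undirected. A vertex colouring $c: V(G)\to\{1,\dots,k\}$ of a graph $G$ is a parity vertex colouring if every (non-empty, simple) path in $G$ contains some colour an odd number of times (counting occurrences on the vertices of the path). The parity vertex chromatic number $\chi_p(G)$ is the minimum number of colours in a parity vertex colouring of $G$. $C_n$ denotes the cycle on $n$ vertices. -}

module Defs where

open import Data.Nat using (ℕ; _+_; _∸_; _≤_; s≤s)
open import Data.Nat.Properties using (1+n≢n)
open import Data.Fin using (Fin; toℕ)
open import Data.Fin.Properties using (_≟_)
open import Data.List using (List; []; _∷_; length)
open import Data.List.Relation.Unary.Linked using (Linked)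
open import Data.List.Relation.Unary.Unique.Propositional using (Unique)
open import Data.Product using (Σ; ∃; _×_; _,_)
open import Data.Sum using (_⊎_; inj₁; inj₂)
open import Data.Nat using (suc)
open import Relation.Binary.PropositionalEquality using (_≡_; _≢_)
import Relation.Binary.PropositionalEquality as ≡
open import Data.Nat.DivMod using (_%_)
open import Relation.Nullary using (¬_; Dec; yes; no)

record Graph : Set₁ where
  field
    n      : ℕ
    Adj    : Fin n → Fin n → Set
    sym    : ∀ {u v} → Adj u v → Adj v u
    irrefl : ∀ {u} → ¬ Adj u u

open Graph public

record Path (G : Graph) : Set where
  constructor mkPath
  field
    verts    : List (Fin (n G))
    nonempty : verts ≢ []
    distinct : Unique verts
    linked   : Linked (Adj G) verts

open Path public

occurrences : ∀ {m k} → (Fin m → Fin k) → Fin k → List (Fin m) → ℕ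
occurrences c col [] = 0
occurrences c col (v ∷ vs) with c v ≟ col
... | yes _ = suc (occurrences c col vs)
... | no  _ = occurrences c col vs

IsParityColouring : (G : Graph) {k : ℕ} → (Fin (n G) → Fin k) → Set
IsParityColouring G {k} c =
  (P : Path G) → ∃ λ (col : Fin k) → occurrences c col (verts P) % 2 ≡ 1

IsParityChromaticNumber : Graph → ℕ → Set
IsParityChromaticNumber G χ =
  (Σ (Fin (n G) → Fin χ) (IsParityColouring G)) ×
  (∀ k (c : Fin (n G) → Fin k) → IsParityColouring G c → χ ≤ k)

CycleAdj : (m : ℕ) → Fin m → Fin m → Set
CycleAdj m i j =
  (toℕ j ≡ suc (toℕ i)) ⊎ (toℕ i ≡ suc (toℕ j)) ⊎
  ((toℕ i ≡ 0) × (toℕ j ≡ m ∸ 1)) ⊎ ((toℕ j ≡ 0) × (toℕ i ≡ m ∸ 1))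

CycleAdj-sym : ∀ {m} {i j : Fin m} → CycleAdj m i j → CycleAdj m j i
CycleAdj-sym (inj₁ p) = inj₂ (inj₁ p)
CycleAdj-sym (inj₂ (inj₁ p)) = inj₁ p
CycleAdj-sym (inj₂ (inj₂ (inj₁ p))) = inj₂ (inj₂ (inj₂ p))
CycleAdj-sym (inj₂ (inj₂ (inj₂ p))) = inj₂ (inj₂ (inj₁ p))

CycleAdj-irrefl : ∀ {m} → 3 ≤ m → {i : Fin m} → ¬ CycleAdj m i i
CycleAdj-irrefl _ (inj₁ p) = 1+n≢n (≡.sym p)
CycleAdj-irrefl _ (inj₂ (inj₁ p)) = 1+n≢n (≡.sym p)
CycleAdj-irrefl (s≤s (s≤s (s≤s _))) (inj₂ (inj₂ (inj₁ (p , q)))) with ≡.trans (≡.sym p) q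
... | ()
CycleAdj-irrefl (s≤s (s≤s (s≤s _))) (inj₂ (inj₂ (inj₂ (p , q)))) with ≡.trans (≡.sym p) q
... | ()

Cycle : (m : ℕ) → 3 ≤ m → Graph
Cycle m h = record
  { n = m ; Adj = CycleAdj m ; sym = CycleAdj-sym ; irrefl = CycleAdj-irrefl h }

module Submission where

-- Upper bound (module CycleColouring): if n ≤ 2^K, give the last vertex a colour of
-- its own and vertex v < n-1 the "ruler" colour of v+1, i.e. its 2-adic valuation,
-- computed with K colours.  A path through the last vertex sees its colour once;
-- any other path traverses an interval of positions, and every interval of
-- [1, 2^K) contains exactly one number of maximal valuation (the ruler lemma).
--
-- Lower bound (module LowerBound): for a parity colouring with k colours let π j be
-- the vector of parities of the colour counts on the vertices 0, …, j-1.  Segments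
-- a, …, b-1 and wrap-around paths s, …, n-1, 0, …, t-1 are paths, so the 2n vectors
-- π a and π a + π n (a < n) are pairwise distinct, whence 2n ≤ 2^k by pigeonhole.

open import Defs hiding (sym; n)

open import Data.Bool using (if_then_else_)
open import Data.Empty using (⊥-elim)
open import Data.Fin as Fin using (Fin; toℕ; inject₁; fromℕ; _↑ˡ_; _↑ʳ_; splitAt; funToFin; finToFun)
open import Data.Fin.Properties
  using (_≟_; toℕ<n; toℕ-injective; toℕ-fromℕ; toℕ-fromℕ<; fromℕ≢inject₁; inject₁-injective;
         ↑ˡ-injective; splitAt-↑ˡ; splitAt-↑ʳ; join-splitAt; pigeonhole; finToFun-funToFin)
  renaming (<⇒≢ to <⇒≢ᶠ)
open import Data.List as List using (List; []; _∷_; _++_; map; reverse; [_]; length)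
open import Data.List.Properties using (unfold-reverse; reverse-++)
open import Data.List.Membership.Propositional using (_∈_)
open import Data.List.Relation.Unary.All as All using (All; []; _∷_)
import Data.List.Relation.Unary.All.Properties as AllP
open import Data.List.Relation.Unary.AllPairs using ([]; _∷_)
open import Data.List.Relation.Unary.Any using (here; there; any?)
import Data.List.Relation.Unary.Any.Properties as AnyP
open import Data.List.Relation.Unary.Linked as Linked using (Linked; []; [-]; _∷_)
import Data.List.Relation.Unary.Linked.Properties as LinkedP
open import Data.List.Relation.Unary.Unique.Propositional using (Unique)
import Data.List.Relation.Unary.Unique.Propositional.Properties as UniqueP
open import Data.Maybe using (just)
open import Data.Maybe.Relation.Binary.Connected using (Connected; just; just-nothing)
open import Data.Nat
  using (ℕ; zero; suc; _+_; _∸_; _*_; _^_; _≤_; _<_; z≤n; s≤s; s≤s⁻¹; ⌈_/2⌉; NonZero; >-nonZero; parity)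
open import Data.Nat.DivMod using (_%_; _mod_; [m+n]%n≡m%n; m<n⇒m%n≡m)
open import Data.Nat.Induction using (<-rec)
open import Data.Nat.Logarithm
  using (⌈log₂_⌉; ⌈log₂⌉-mono-≤; ⌈log₂⌈n/2⌉⌉≡⌈log₂n⌉∸1; ⌈log₂2*n⌉≡1+⌈log₂n⌉; ⌈log₂2^n⌉≡n)
open import Data.Nat.Properties
  using (+-assoc; +-comm; +-identityʳ; +-suc; suc-injective; ≤-refl; ≤-trans; <-trans; <-≤-trans;
         <⇒≤; <⇒≢; <⇒≱; ≤∧≢⇒<; ≮⇒≥; ≰⇒>; <-cmp; _<?_; _≤?_; m<m+n; m≤m+n; m+n∸m≡n;
         m+[n∸m]≡n; m<n⇒0<n∸m; n<1+n; +-cancelˡ-<; +-monoʳ-<; +-monoˡ-≤; *-monoʳ-≤;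
         ⌊n/2⌋+⌈n/2⌉≡n; ⌊n/2⌋≤⌈n/2⌉; ⌈n/2⌉<n; module ≤-Reasoning)
  renaming (_≟_ to _≟ℕ_)
open import Data.Parity.Base as ℙ using (Parity; 0ℙ; 1ℙ)
import Data.Parity.Properties as ℙ
open import Data.Product using (Σ; ∃; _×_; _,_; proj₁; proj₂)
open import Data.Sum using (_⊎_; inj₁; inj₂)
open import Function using (_∘_)
open import Relation.Binary.Definitions using (tri<; tri≈; tri>)
open import Relation.Binary.PropositionalEquality
  using (_≡_; _≢_; _≗_; refl; sym; trans; cong; cong₂; subst; subst₂; module ≡-Reasoning)
open import Relation.Nullary using (¬_; does; yes; no)

hit : ∀ {k} → Fin k → Fin k → ℕ
hit a b = if does (a ≟ b) then 1 else 0

hit-≡ : ∀ {k} (a : Fin k) → hit a a ≡ 1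
hit-≡ a with a ≟ a
... | yes _  = refl
... | no a≢a = ⊥-elim (a≢a refl)

hit-≢ : ∀ {k} {a b : Fin k} → a ≢ b → hit a b ≡ 0
hit-≢ {a = a} {b} a≢b with a ≟ b
... | yes a≡b = ⊥-elim (a≢b a≡b)
... | no _    = refl

hit-inject : ∀ {k l} {e : Fin k → Fin l} → (∀ {a b} → e a ≡ e b → a ≡ b) →
             ∀ a b → hit (e a) (e b) ≡ hit a b
hit-inject {e = e} e-inj a b with a ≟ b
... | yes refl = hit-≡ (e a)
... | no a≢b   = hit-≢ (a≢b ∘ e-inj)

count : ∀ {A : Set} {k} → (A → Fin k) → Fin k → List A → ℕ
count f col []       = 0
count f col (x ∷ xs) = hit (f x) col + count f col xs

occurrences≡count : ∀ {m k} (c : Fin m → Fin k) col xs →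
                    occurrences c col xs ≡ count c col xs
occurrences≡count c col []       = refl
occurrences≡count c col (x ∷ xs) with c x ≟ col
... | yes _ = cong suc (occurrences≡count c col xs)
... | no  _ = occurrences≡count c col xs

once⇒odd : ∀ {m k} (c : Fin m → Fin k) col vs → count c col vs ≡ 1 → occurrences c col vs % 2 ≡ 1
once⇒odd c col vs once = cong (_% 2) (trans (occurrences≡count c col vs) once)

count-++ : ∀ {A : Set} {k} (f : A → Fin k) col xs ys →
           count f col (xs ++ ys) ≡ count f col xs + count f col ys
count-++ f col []       ys = refl
count-++ f col (x ∷ xs) ys =
  trans (cong (hit (f x) col +_) (count-++ f col xs ys))
        (sym (+-assoc (hit (f x) col) (count f col xs) (count f col ys)))

count-map : ∀ {A B : Set} {k} (f : B → Fin k) (g : A → B) col xs →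
            count f col (map g xs) ≡ count (f ∘ g) col xs
count-map f g col []       = refl
count-map f g col (x ∷ xs) = cong (hit (f (g x)) col +_) (count-map f g col xs)

count-cong : ∀ {A : Set} {k} {f g : A → Fin k} col {xs} →
             All (λ x → f x ≡ g x) xs → count f col xs ≡ count g col xs
count-cong col []       = refl
count-cong col (e ∷ es) = cong₂ _+_ (cong (λ y → hit y col) e) (count-cong col es)

count-inject : ∀ {A : Set} {k l} {e : Fin k → Fin l} → (∀ {a b} → e a ≡ e b → a ≡ b) →
               ∀ (f : A → Fin k) col xs → count (e ∘ f) (e col) xs ≡ count f col xs
count-inject e-inj f col []       = refl
count-inject e-inj f col (x ∷ xs) =
  cong₂ _+_ (hit-inject e-inj (f x) col) (count-inject e-inj f col xs)

count-none : ∀ {A : Set} {k} (f : A → Fin k) col {xs} →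
             All (λ x → f x ≢ col) xs → count f col xs ≡ 0
count-none f col []         = refl
count-none f col (fx≢ ∷ ps) = cong₂ _+_ (hit-≢ fx≢) (count-none f col ps)

count-unique : ∀ {A : Set} {k} (f : A → Fin k) col {x xs} → Unique xs → x ∈ xs →
               f x ≡ col → (∀ {y} → f y ≡ col → y ≡ x) → count f col xs ≡ 1
count-unique f col (x∉ ∷ _) (here refl) fx≡col only =
  cong₂ _+_ (trans (cong (λ y → hit y col) fx≡col) (hit-≡ col))
            (count-none f col (All.map (λ x≢y fy≡col → x≢y (sym (only fy≡col))) x∉))
count-unique f col (z∉ ∷ u) (there x∈) fx≡col only =
  cong₂ _+_ (hit-≢ (λ fz≡col → All.lookup z∉ x∈ (only fz≡col)))
            (count-unique f col u x∈ fx≡col only)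

count-reverse : ∀ {A : Set} {k} (f : A → Fin k) col xs →
                count f col (reverse xs) ≡ count f col xs
count-reverse f col []       = refl
count-reverse f col (x ∷ xs) = begin
  count f col (reverse (x ∷ xs))                  ≡⟨ cong (count f col) (unfold-reverse x xs) ⟩
  count f col (reverse xs ++ [ x ])               ≡⟨ count-++ f col (reverse xs) [ x ] ⟩
  count f col (reverse xs) + (hit (f x) col + 0)  ≡⟨ cong₂ _+_ (count-reverse f col xs) (+-identityʳ _) ⟩
  count f col xs + hit (f x) col                  ≡⟨ +-comm (count f col xs) _ ⟩
  count f col (x ∷ xs)                            ∎
  where open ≡-Reasoning

range : ℕ → ℕ → List ℕ
range a zero    = []
range a (suc l) = a ∷ range (suc a) l

range-++ : ∀ a l₁ l₂ → range a (l₁ + l₂) ≡ range a l₁ ++ range (a + l₁) l₂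
range-++ a zero     l₂ = cong (λ b → range b l₂) (sym (+-identityʳ a))
range-++ a (suc l₁) l₂ = cong (a ∷_) (trans (range-++ (suc a) l₁ l₂)
  (cong (λ b → range (suc a) l₁ ++ range b l₂) (sym (+-suc a l₁))))

range-snoc : ∀ a l → range a (suc l) ≡ range a l ++ [ a + l ]
range-snoc a l = trans (cong (range a) (+-comm 1 l)) (range-++ a l 1)

last-snoc : ∀ {A : Set} (xs : List A) y → List.last (xs ++ [ y ]) ≡ just y
last-snoc []            y = refl
last-snoc (x ∷ [])      y = refl
last-snoc (x ∷ x′ ∷ xs) y = last-snoc (x′ ∷ xs) y

last-range : ∀ a l → List.last (range a (suc l)) ≡ just (a + l)
last-range a l = trans (cong List.last (range-snoc a l)) (last-snoc (range a l) (a + l))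

range-shift : ∀ d b l → map (d +_) (range b l) ≡ range (d + b) l
range-shift d b zero    = refl
range-shift d b (suc l) =
  cong (d + b ∷_) (trans (range-shift d (suc b) l) (cong (λ a → range a l) (+-suc d b)))

range-∈ : ∀ {x} a l → a ≤ x → x < a + l → x ∈ range a l
range-∈ {x} a zero    a≤x x<a+0 = ⊥-elim (<⇒≱ (subst (x <_) (+-identityʳ a) x<a+0) a≤x)
range-∈ {x} a (suc l) a≤x x<a+l with a ≟ℕ x
... | yes refl = here refl
... | no  a≢x  = there (range-∈ (suc a) l (≤∧≢⇒< a≤x a≢x) (subst (x <_) (+-suc a l) x<a+l))

range-∈⁻ : ∀ {x} a l → x ∈ range a l → a ≤ x × x < a + l
range-∈⁻ a (suc l) (here refl) = ≤-refl , m<m+n a (s≤s z≤n)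
range-∈⁻ {x} a (suc l) (there x∈) with range-∈⁻ (suc a) l x∈
... | a<x , x<1+a+l = <⇒≤ a<x , subst (x <_) (sym (+-suc a l)) x<1+a+l

range-all : ∀ {P : ℕ → Set} a l → (∀ x → a ≤ x → x < a + l → P x) → All P (range a l)
range-all a l p = All.tabulate λ {x} x∈ → let a≤x , x<a+l = range-∈⁻ a l x∈ in p x a≤x x<a+l

range-unique : ∀ a l → Unique (range a l)
range-unique a zero    = []
range-unique a (suc l) = range-all (suc a) l (λ x a<x _ → <⇒≢ a<x) ∷ range-unique (suc a) l

Step Up Down : ℕ → ℕ → Set
Step x y = Up x y ⊎ Down x y
Up   x y = y ≡ suc x
Down x y = x ≡ suc y

range-up : ∀ a l → Linked Up (range a l)
range-up a zero          = []
range-up a (suc zero)    = [-]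
range-up a (suc (suc l)) = refl ∷ range-up (suc a) (suc l)

monotone : ∀ {xs} → Linked Step xs → Unique xs → Linked Up xs ⊎ Linked Down xs
monotone []  _ = inj₁ []
monotone [-] _ = inj₁ [-]
monotone (step ∷ steps) (_ ∷ u) with step | monotone steps u
... | inj₁ up | inj₁ ups = inj₁ (up ∷ ups)
... | inj₂ dn | inj₂ dns = inj₂ (dn ∷ dns)
... | inj₁ up | inj₂ [-] = inj₁ (up ∷ [-])
... | inj₂ dn | inj₁ [-] = inj₂ (dn ∷ [-])
monotone (_ ∷ _) ((_ ∷ x≢z ∷ _) ∷ _) | inj₁ up | inj₂ (dn ∷ _) = ⊥-elim (x≢z (suc-injective (trans (sym up) dn)))
monotone (_ ∷ _) ((_ ∷ x≢z ∷ _) ∷ _) | inj₂ dn | inj₁ (up ∷ _) = ⊥-elim (x≢z (trans dn (sym up)))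

ascending : ∀ {x xs} → Linked Up (x ∷ xs) → x ∷ xs ≡ range x (suc (length xs))
ascending [-]                     = refl
ascending {x} {_ ∷ ys} (up ∷ ups) =
  cong (x ∷_) (trans (ascending ups) (cong (λ a → range a (suc (length ys))) up))

descending : ∀ {x xs} → Linked Down (x ∷ xs) →
             ∃ λ b → x ≡ b + length xs × x ∷ xs ≡ reverse (range b (suc (length xs)))
descending {x} [-] = x , sym (+-identityʳ x) , refl
descending {x} {y ∷ ys} (dn ∷ dns) with descending dns
... | b , y≡b+n , walk = b , x≡b+1+n , (begin
  x ∷ y ∷ ys                                  ≡⟨ cong (x ∷_) walk ⟩
  x ∷ reverse (range b (suc n))               ≡⟨ cong (_∷ reverse (range b (suc n))) x≡b+1+n ⟩
  (b + suc n) ∷ reverse (range b (suc n))     ≡⟨ reverse-++ (range b (suc n)) [ b + suc n ] ⟨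
  reverse (range b (suc n) ++ [ b + suc n ])  ≡⟨ cong reverse (range-snoc b (suc n)) ⟨
  reverse (range b (suc (suc n)))             ∎)
  where
  open ≡-Reasoning
  n = length ys
  x≡b+1+n : x ≡ b + suc n
  x≡b+1+n = trans dn (trans (cong suc y≡b+n) (sym (+-suc b n)))

Traverses : List ℕ → List ℕ → Set
Traverses xs ys = xs ≡ ys ⊎ xs ≡ reverse ys

traverses-∈ : ∀ {xs ys y} → Traverses xs ys → y ∈ ys → y ∈ xs
traverses-∈ (inj₁ refl) y∈ys = y∈ys
traverses-∈ (inj₂ refl) y∈ys = AnyP.reverse⁺ y∈ys

traverses-count : ∀ {k} (f : ℕ → Fin k) col {xs ys} → Traverses xs ys → count f col xs ≡ count f col ys
traverses-count f col {ys = ys} (inj₁ refl) = refl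
traverses-count f col {ys = ys} (inj₂ refl) = count-reverse f col ys

interval-shape : ∀ {x xs} → Linked Step (x ∷ xs) → Unique (x ∷ xs) →
                 ∃ λ b → ∃ λ l → Traverses (x ∷ xs) (range b (suc l))
interval-shape {x} {xs} steps u with monotone steps u
... | inj₁ ups = x , length xs , inj₁ (ascending ups)
... | inj₂ dns with descending dns
...   | b , _ , walk = b , length xs , inj₂ walk

linked-weaken : ∀ {A : Set} {P : A → Set} {R S : A → A → Set} →
                (∀ {x y} → P x → P y → R x y → S x y) →
                ∀ {xs} → All P xs → Linked R xs → Linked S xs
linked-weaken w _              []       = []
linked-weaken w _              [-]      = [-]
linked-weaken w (px ∷ py ∷ ps) (r ∷ rs) = w px py r ∷ linked-weaken w (py ∷ ps) rs

-- ρ k colours the positions 1, …, 2^(k+1) - 1 with the colours 0, …, k: the centre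
-- 2^k gets the new colour k, and both halves beside it repeat the colouring ρ (k-1),
-- the right half translated by 2^k.  (So ρ k x is the 2-adic valuation of x.)
ρ : (k : ℕ) → ℕ → Fin (suc k)
ρ zero    _ = Fin.zero
ρ (suc k) x with <-cmp x (2 ^ suc k)
... | tri< _ _ _ = inject₁ (ρ k x)
... | tri≈ _ _ _ = fromℕ (suc k)
... | tri> _ _ _ = inject₁ (ρ k (x ∸ 2 ^ suc k))

ρ-below : ∀ k {x} → x < 2 ^ suc k → ρ (suc k) x ≡ inject₁ (ρ k x)
ρ-below k {x} x<H with <-cmp x (2 ^ suc k)
... | tri< _ _ _   = refl
... | tri≈ x≮H _ _ = ⊥-elim (x≮H x<H)
... | tri> x≮H _ _ = ⊥-elim (x≮H x<H)

ρ-above : ∀ k {y} → 1 ≤ y → ρ (suc k) (2 ^ suc k + y) ≡ inject₁ (ρ k y)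
ρ-above k {y} 1≤y with <-cmp (2 ^ suc k + y) (2 ^ suc k)
... | tri> _ _ _     = cong (inject₁ ∘ ρ k) (m+n∸m≡n (2 ^ suc k) y)
... | tri< _ _ H≮H+y = ⊥-elim (H≮H+y (m<m+n (2 ^ suc k) 1≤y))
... | tri≈ _ _ H≮H+y = ⊥-elim (H≮H+y (m<m+n (2 ^ suc k) 1≤y))

ρ-centre : ∀ k → ρ (suc k) (2 ^ suc k) ≡ fromℕ (suc k)
ρ-centre k with <-cmp (2 ^ suc k) (2 ^ suc k)
... | tri≈ _ _ _   = refl
... | tri< _ H≢H _ = ⊥-elim (H≢H refl)
... | tri> _ H≢H _ = ⊥-elim (H≢H refl)

ρ-centre-only : ∀ k {x} → ρ (suc k) x ≡ fromℕ (suc k) → x ≡ 2 ^ suc k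
ρ-centre-only k {x} ρx≡new with <-cmp x (2 ^ suc k)
... | tri< _ _ _   = ⊥-elim (fromℕ≢inject₁ (sym ρx≡new))
... | tri≈ _ x≡H _ = x≡H
... | tri> _ _ _   = ⊥-elim (fromℕ≢inject₁ (sym ρx≡new))

count-below : ∀ k col a n → a + n ≤ 2 ^ suc k →
              count (ρ (suc k)) (inject₁ col) (range a n) ≡ count (ρ k) col (range a n)
count-below k col a n a+n≤H =
  trans (count-cong (inject₁ col) (range-all a n (λ x _ x<a+n → ρ-below k (<-≤-trans x<a+n a+n≤H))))
        (count-inject inject₁-injective (ρ k) col (range a n))

count-above : ∀ k col b n → 1 ≤ b →
              count (ρ (suc k)) (inject₁ col) (range (2 ^ suc k + b) n) ≡ count (ρ k) col (range b n)
count-above k col b n 1≤b = begin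
  count (ρ (suc k)) (inject₁ col) (range (H + b) n)         ≡⟨ cong (count (ρ (suc k)) (inject₁ col)) (range-shift H b n) ⟨
  count (ρ (suc k)) (inject₁ col) (map (H +_) (range b n))  ≡⟨ count-map (ρ (suc k)) (H +_) (inject₁ col) (range b n) ⟩
  count (ρ (suc k) ∘ (H +_)) (inject₁ col) (range b n)      ≡⟨ count-cong (inject₁ col) (range-all b n (λ y b≤y _ → ρ-above k (≤-trans 1≤b b≤y))) ⟩
  count (inject₁ ∘ ρ k) (inject₁ col) (range b n)           ≡⟨ count-inject inject₁-injective (ρ k) col (range b n) ⟩
  count (ρ k) col (range b n)                               ∎
  where
  open ≡-Reasoning
  H = 2 ^ suc k

count-centre : ∀ k a l → a ≤ 2 ^ suc k → 2 ^ suc k ≤ a + l →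
               count (ρ (suc k)) (fromℕ (suc k)) (range a (suc l)) ≡ 1
count-centre k a l a≤H H≤a+l =
  count-unique (ρ (suc k)) (fromℕ (suc k)) (range-unique a (suc l))
    (range-∈ a (suc l) a≤H (subst (2 ^ suc k <_) (sym (+-suc a l)) (s≤s H≤a+l)))
    (ρ-centre k) (ρ-centre-only k)

-- The ruler lemma: in every interval of [1, 2^(k+1)) some colour of ρ k occurs
-- exactly once.  By induction on k, according as the interval lies left of the
-- centre, right of it, or contains it.
ruler : ∀ k a l → 1 ≤ a → a + l < 2 ^ suc k → ∃ λ col → count (ρ k) col (range a (suc l)) ≡ 1
ruler zero    (suc zero)    zero    _ _                 = Fin.zero , refl
ruler zero    (suc zero)    (suc l) _ (s≤s (s≤s ()))
ruler zero    (suc (suc a)) l       _ (s≤s (s≤s ()))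
ruler (suc k) a l 1≤a a+l<2H with a + l <? 2 ^ suc k | 2 ^ suc k <? a
... | yes a+l<H | _ =
  let col , once = ruler k a l 1≤a a+l<H in
  inject₁ col , trans (count-below k col a (suc l) (subst (_≤ 2 ^ suc k) (sym (+-suc a l)) a+l<H)) once
... | no _ | yes H<a =
  let col , once = ruler k b l 1≤b b+l<H in
  inject₁ col , (begin
    count (ρ (suc k)) (inject₁ col) (range a (suc l))        ≡⟨ cong (λ x → count (ρ (suc k)) (inject₁ col) (range x (suc l))) H+b≡a ⟨
    count (ρ (suc k)) (inject₁ col) (range (H + b) (suc l))  ≡⟨ count-above k col b (suc l) 1≤b ⟩
    count (ρ k) col (range b (suc l))                        ≡⟨ once ⟩
    1                                                        ∎)
  where
  open ≡-Reasoning
  H = 2 ^ suc k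
  b = a ∸ H
  1≤b : 1 ≤ b
  1≤b = m<n⇒0<n∸m H<a
  H+b≡a : H + b ≡ a
  H+b≡a = m+[n∸m]≡n (<⇒≤ H<a)
  b+l<H : b + l < H
  b+l<H = +-cancelˡ-< H (b + l) H (subst₂ _<_ (trans (cong (_+ l) (sym H+b≡a)) (+-assoc H b l))
                                              (cong (H +_) (+-identityʳ H)) a+l<2H)
... | no a+l≮H | no H≮a = fromℕ (suc k) , count-centre k a l (≮⇒≥ H≮a) (≮⇒≥ a+l≮H)

module CycleColouring (m j : ℕ) (hm : 3 ≤ suc m) (small : suc m ≤ 2 ^ suc j) where

  last : Fin (suc m)
  last = fromℕ m

  extra : Fin (suc j + 1)
  extra = suc j ↑ʳ Fin.zero

  colour : Fin (suc m) → Fin (suc j + 1)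
  colour v with v ≟ last
  ... | yes _ = extra
  ... | no  _ = ρ j (suc (toℕ v)) ↑ˡ 1

  colour-last : colour last ≡ extra
  colour-last with last ≟ last
  ... | yes _      = refl
  ... | no last≢last = ⊥-elim (last≢last refl)

  colour-other : ∀ {v} → v ≢ last → colour v ≡ ρ j (suc (toℕ v)) ↑ˡ 1
  colour-other {v} v≢last with v ≟ last
  ... | yes v≡last = ⊥-elim (v≢last v≡last)
  ... | no  _      = refl

  extra-only : ∀ {v} → colour v ≡ extra → v ≡ last
  extra-only {v} colour≡extra with v ≟ last
  ... | yes v≡last = v≡last
  ... | no  _      = ⊥-elim (↑ˡ≢↑ʳ colour≡extra)
    where
    ↑ˡ≢↑ʳ : ∀ {i : Fin (suc j)} {l : Fin 1} → i ↑ˡ 1 ≢ suc j ↑ʳ l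
    ↑ˡ≢↑ʳ {i} {l} eq
      with trans (sym (splitAt-↑ˡ (suc j) i 1)) (trans (cong (splitAt (suc j)) eq) (splitAt-↑ʳ (suc j) 1 l))
    ... | ()

  position<m : ∀ {v} → v ≢ last → toℕ v < m
  position<m {v} v≢last =
    ≤∧≢⇒< (s≤s⁻¹ (toℕ<n v)) (λ v≡m → v≢last (toℕ-injective (trans v≡m (sym (toℕ-fromℕ m)))))

  through-last : ∀ {vs} → Unique vs → last ∈ vs → count colour extra vs ≡ 1
  through-last u last∈vs = count-unique colour extra u last∈vs colour-last extra-only

  -- Away from the last vertex the cycle is the path 0, 1, …, m-1.
  step : ∀ {v w} → v ≢ last → w ≢ last → CycleAdj (suc m) v w → Step (toℕ v) (toℕ w)
  step _      _      (inj₁ up)                      = inj₁ up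
  step _      _      (inj₂ (inj₁ down))             = inj₂ down
  step _      w≢last (inj₂ (inj₂ (inj₁ (_ , w≡m)))) = ⊥-elim (w≢last (toℕ-injective (trans w≡m (sym (toℕ-fromℕ m)))))
  step v≢last _      (inj₂ (inj₂ (inj₂ (_ , v≡m)))) = ⊥-elim (v≢last (toℕ-injective (trans v≡m (sym (toℕ-fromℕ m)))))

  -- A path avoiding the last vertex traverses an interval [b, b+l] of positions
  -- below m, on which the colouring is the ruler colouring of [b+1, b+l+1].
  avoiding-last : ∀ {v vs} → Unique (v ∷ vs) → Linked (CycleAdj (suc m)) (v ∷ vs) →
                  All (_≢ last) (v ∷ vs) → ∃ λ col → count colour col (v ∷ vs) ≡ 1
  avoiding-last {v} {vs} u linked avoid
    with interval-shape (LinkedP.map⁺ (linked-weaken step avoid linked)) (UniqueP.map⁺ toℕ-injective u)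
  ... | b , l , walk with ruler j (suc b) l (s≤s z≤n) (<-≤-trans (s≤s b+l<m) small)
    where
    b+l<m : b + l < m
    b+l<m = All.lookup (AllP.map⁺ {P = _< m} (All.map position<m avoid))
                       (traverses-∈ walk (range-∈ b (suc l) (m≤m+n b l) (+-monoʳ-< b (n<1+n l))))
  ... | col , once = col ↑ˡ 1 , (begin
    count colour (col ↑ˡ 1) (v ∷ vs)                       ≡⟨ count-cong (col ↑ˡ 1) (All.map colour-other avoid) ⟩
    count ((_↑ˡ 1) ∘ ρ j ∘ suc ∘ toℕ) (col ↑ˡ 1) (v ∷ vs)  ≡⟨ count-inject (λ {a} {b} → ↑ˡ-injective 1 a b) (ρ j ∘ suc ∘ toℕ) col (v ∷ vs) ⟩
    count (ρ j ∘ suc ∘ toℕ) col (v ∷ vs)                   ≡⟨ count-map (ρ j ∘ suc) toℕ col (v ∷ vs) ⟨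
    count (ρ j ∘ suc) col (map toℕ (v ∷ vs))               ≡⟨ traverses-count (ρ j ∘ suc) col walk ⟩
    count (ρ j ∘ suc) col (range b (suc l))                ≡⟨ count-map (ρ j) suc col (range b (suc l)) ⟨
    count (ρ j) col (map suc (range b (suc l)))            ≡⟨ cong (count (ρ j) col) (range-shift 1 b (suc l)) ⟩
    count (ρ j) col (range (suc b) (suc l))                ≡⟨ once ⟩
    1                                                      ∎)
    where open ≡-Reasoning

  exactly-once : ∀ v vs → Unique (v ∷ vs) → Linked (CycleAdj (suc m)) (v ∷ vs) →
                 ∃ λ col → count colour col (v ∷ vs) ≡ 1
  exactly-once v vs u linked with any? (last ≟_) (v ∷ vs)
  ... | yes last∈vs = extra , through-last u last∈vs
  ... | no  last∉vs = avoiding-last u linked (All.map (_∘ sym) (AllP.¬Any⇒All¬ (v ∷ vs) last∉vs))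

  isParity : IsParityColouring (Cycle (suc m) hm) colour
  isParity (mkPath []       nonempty _ _)      = ⊥-elim (nonempty refl)
  isParity (mkPath (v ∷ vs) _        u linked) =
    let col , once = exactly-once v vs u linked in col , once⇒odd colour col (v ∷ vs) once

parity-colouring : ∀ {m} (hm : 3 ≤ m) K → m ≤ 2 ^ K →
                   Σ (Fin m → Fin (K + 1)) (IsParityColouring (Cycle m hm))
parity-colouring (s≤s (s≤s (s≤s _))) zero (s≤s ())
parity-colouring {suc m} hm (suc j) small =
  CycleColouring.colour m j hm small , CycleColouring.isParity m j hm small

odd⇒1ℙ : ∀ n → n % 2 ≡ 1 → parity n ≡ 1ℙ
odd⇒1ℙ (suc zero)    _   = refl
odd⇒1ℙ (suc (suc n)) odd = odd⇒1ℙ n (trans (sym ([m+n]%n≡m%n n 2)) (trans (cong (_% 2) (+-comm n 2)) odd))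

p≢p+1ℙ : ∀ p → p ≢ p ℙ.+ 1ℙ
p≢p+1ℙ 0ℙ ()
p≢p+1ℙ 1ℙ ()

ℙ-self-cancel : ∀ p x → x ℙ.+ (p ℙ.+ (p ℙ.+ x)) ≡ 0ℙ
ℙ-self-cancel 0ℙ 0ℙ = refl
ℙ-self-cancel 0ℙ 1ℙ = refl
ℙ-self-cancel 1ℙ 0ℙ = refl
ℙ-self-cancel 1ℙ 1ℙ = refl

ℙ-swap : ∀ {x y z} → x ≡ y ℙ.+ z → y ≡ x ℙ.+ z
ℙ-swap {y = 0ℙ} {0ℙ} refl = refl
ℙ-swap {y = 0ℙ} {1ℙ} refl = refl
ℙ-swap {y = 1ℙ} {0ℙ} refl = refl
ℙ-swap {y = 1ℙ} {1ℙ} refl = refl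

bit : Parity → Fin 2
bit 0ℙ = Fin.zero
bit 1ℙ = Fin.suc Fin.zero

bit-injective : ∀ {p q} → bit p ≡ bit q → p ≡ q
bit-injective {0ℙ} {0ℙ} _ = refl
bit-injective {1ℙ} {1ℙ} _ = refl

-- Pigeonhole: a family of pairwise different k-tuples of parities has at most 2^k
-- members (a k-tuple of bits is encoded as a number below 2^k).
distinct-parity-vectors : ∀ {N k} (v : Fin N → Fin k → Parity) →
                          (∀ i j → v i ≗ v j → i ≡ j) → N ≤ 2 ^ k
distinct-parity-vectors v v-injective = ≮⇒≥ λ 2^k<N →
  let i , j , i<j , same-code = pigeonhole 2^k<N (λ i → funToFin (bit ∘ v i))
      same : v i ≗ v j
      same col = bit-injective (begin
        bit (v i col)                        ≡⟨ finToFun-funToFin (bit ∘ v i) col ⟨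
        finToFun (funToFin (bit ∘ v i)) col  ≡⟨ cong (λ code → finToFun code col) same-code ⟩
        finToFun (funToFin (bit ∘ v j)) col  ≡⟨ finToFun-funToFin (bit ∘ v j) col ⟩
        bit (v j col)                        ∎)
  in <⇒≢ᶠ i<j (v-injective i j same)
  where open ≡-Reasoning

module LowerBound {m k : ℕ} (hm : 3 ≤ m) (c : Fin m → Fin k)
                  (isParity : IsParityColouring (Cycle m hm) c) where

  instance
    m-nonZero : NonZero m
    m-nonZero = >-nonZero (<-≤-trans (s≤s z≤n) hm)

  fin : ℕ → Fin m
  fin x = x mod m

  toℕ-fin : ∀ {x} → x < m → toℕ (fin x) ≡ x
  toℕ-fin x<m = trans (toℕ-fromℕ< _) (m<n⇒m%n≡m x<m)

  positions-of : ∀ {xs} → All (_< m) xs → map toℕ (map fin xs) ≡ xs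
  positions-of []           = refl
  positions-of (x<m ∷ xs<m) = cong₂ _∷_ (toℕ-fin x<m) (positions-of xs<m)

  CycleStep : ℕ → ℕ → Set
  CycleStep x y = Up x y ⊎ (x ≡ m ∸ 1 × y ≡ 0)

  cycle-step : ∀ {x y} → x < m → y < m → CycleStep x y → CycleAdj m (fin x) (fin y)
  cycle-step x<m y<m (inj₁ up)         = inj₁ (trans (toℕ-fin y<m) (trans up (cong suc (sym (toℕ-fin x<m)))))
  cycle-step x<m y<m (inj₂ (x≡ , y≡0)) = inj₂ (inj₂ (inj₂ (trans (toℕ-fin y<m) y≡0 , trans (toℕ-fin x<m) x≡)))

  path : ∀ p ps → Unique (p ∷ ps) → All (_< m) (p ∷ ps) → Linked CycleStep (p ∷ ps) → Path (Cycle m hm)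
  path p ps unique bounded steps = mkPath (map fin (p ∷ ps)) (λ ())
    (UniqueP.map⁻ (subst Unique (sym (positions-of bounded)) unique))
    (LinkedP.map⁺ (linked-weaken cycle-step bounded steps))

  γ : ℕ → Fin k
  γ = c ∘ fin

  odd-colour : ∀ p ps → Unique (p ∷ ps) → All (_< m) (p ∷ ps) → Linked CycleStep (p ∷ ps) →
               ∃ λ col → parity (count γ col (p ∷ ps)) ≡ 1ℙ
  odd-colour p ps unique bounded steps with isParity (path p ps unique bounded steps)
  ... | col , odd = col , (begin
    parity (count γ col (p ∷ ps))                  ≡⟨ cong parity (count-map c fin col (p ∷ ps)) ⟨
    parity (count c col (map fin (p ∷ ps)))        ≡⟨ cong parity (occurrences≡count c col (map fin (p ∷ ps))) ⟨
    parity (occurrences c col (map fin (p ∷ ps)))  ≡⟨ odd⇒1ℙ (occurrences c col (map fin (p ∷ ps))) odd ⟩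
    1ℙ                                             ∎)
    where open ≡-Reasoning

  π : ℕ → Fin k → Parity
  π j col = parity (count γ col (range 0 j))

  π-+ : ∀ a d col → π (a + d) col ≡ π a col ℙ.+ parity (count γ col (range a d))
  π-+ a d col = begin
    parity (count γ col (range 0 (a + d)))                      ≡⟨ cong (parity ∘ count γ col) (range-++ 0 a d) ⟩
    parity (count γ col (range 0 a ++ range a d))               ≡⟨ cong parity (count-++ γ col (range 0 a) (range a d)) ⟩
    parity (count γ col (range 0 a) + count γ col (range a d))  ≡⟨ ℙ.+-homo-+ (count γ col (range 0 a)) _ ⟩
    π a col ℙ.+ parity (count γ col (range a d))                ∎
    where open ≡-Reasoning

  -- The vertices a, …, a+l form a path, so some colour changes parity between
  -- π a and π (a+l+1).
  segment-separates : ∀ a l → a + suc l ≤ m → ¬ (π a ≗ π (a + suc l))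
  segment-separates a l a+1+l≤m same
    with odd-colour a (range (suc a) l) (range-unique a (suc l))
                    (range-all a (suc l) (λ _ _ x<a+1+l → <-≤-trans x<a+1+l a+1+l≤m))
                    (Linked.map inj₁ (range-up a (suc l)))
  ... | col , odd = p≢p+1ℙ (π a col) (begin
    π a col                                             ≡⟨ same col ⟩
    π (a + suc l) col                                   ≡⟨ π-+ a (suc l) col ⟩
    π a col ℙ.+ parity (count γ col (range a (suc l)))  ≡⟨ cong (π a col ℙ.+_) odd ⟩
    π a col ℙ.+ 1ℙ                                      ∎)
    where open ≡-Reasoning

  prefixes-differ : ∀ {a b} → a < b → b ≤ m → ¬ (π a ≗ π b)
  prefixes-differ {a} {b} a<b b≤m same =
    segment-separates a l (subst (_≤ m) (sym a+1+l≡b) b≤m) (subst (λ j → π a ≗ π j) (sym a+1+l≡b) same)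
    where
    l = b ∸ suc a
    a+1+l≡b : a + suc l ≡ b
    a+1+l≡b = trans (+-suc a l) (m+[n∸m]≡n a<b)

  -- The positions s, …, m-1, 0, …, t-1, going once round the end of the cycle.
  wrap : ℕ → ℕ → ℕ → List ℕ
  wrap s r t = range s (suc r) ++ range 0 t

  wrap-unique : ∀ s r t → t ≤ s → Unique (wrap s r t)
  wrap-unique s r t t≤s = UniqueP.++⁺ (range-unique s (suc r)) (range-unique 0 t)
    (λ (x∈left , x∈right) → <⇒≱ (<-≤-trans (proj₂ (range-∈⁻ 0 t x∈right)) t≤s) (proj₁ (range-∈⁻ s (suc r) x∈left)))

  wrap-bounded : ∀ s r t → s + suc r ≡ m → t ≤ s → All (_< m) (wrap s r t)
  wrap-bounded s r t s+1+r≡m t≤s = AllP.++⁺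
    (range-all s (suc r) (λ x _ x<s+1+r → subst (x <_) s+1+r≡m x<s+1+r))
    (range-all 0 t (λ x _ x<t → <-trans (<-≤-trans x<t t≤s) (subst (s <_) s+1+r≡m (m<m+n s (s≤s z≤n)))))

  wrap-steps : ∀ s r t → s + suc r ≡ m → Linked CycleStep (wrap s r t)
  wrap-steps s r t s+1+r≡m = LinkedP.++⁺ (Linked.map inj₁ (range-up s (suc r)))
    (subst (λ end → Connected CycleStep end (List.head (range 0 t))) (sym (last-range s r)) (junction t))
    (Linked.map inj₁ (range-up 0 t))
    where
    junction : ∀ t → Connected CycleStep (just (s + r)) (List.head (range 0 t))
    junction zero    = just-nothing
    junction (suc t) = just (inj₂ (cong (_∸ 1) (trans (sym (+-suc s r)) s+1+r≡m) , refl))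

  -- The vertices s, …, m-1, 0, …, t-1 (t ≤ s) form a path, so π t ≠ π s + π m.
  wrap-separates : ∀ s r t → s + suc r ≡ m → t ≤ s → ¬ (∀ col → π t col ≡ π s col ℙ.+ π m col)
  wrap-separates s r t s+1+r≡m t≤s same
    with odd-colour s (range (suc s) r ++ range 0 t) (wrap-unique s r t t≤s)
                    (wrap-bounded s r t s+1+r≡m t≤s) (wrap-steps s r t s+1+r≡m)
  ... | col , odd = 0ℙ≢1ℙ (begin
    0ℙ                                                                ≡⟨ ℙ-self-cancel (π s col) x ⟨
    x ℙ.+ (π s col ℙ.+ (π s col ℙ.+ x))                               ≡⟨ cong (λ q → x ℙ.+ (π s col ℙ.+ q)) (π-+ s (suc r) col) ⟨
    x ℙ.+ (π s col ℙ.+ π (s + suc r) col)                             ≡⟨ cong (λ j → x ℙ.+ (π s col ℙ.+ π j col)) s+1+r≡m ⟩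
    x ℙ.+ (π s col ℙ.+ π m col)                                       ≡⟨ cong (x ℙ.+_) (same col) ⟨
    x ℙ.+ π t col                                                     ≡⟨ ℙ.+-homo-+ (count γ col (range s (suc r))) _ ⟨
    parity (count γ col (range s (suc r)) + count γ col (range 0 t))  ≡⟨ cong parity (count-++ γ col (range s (suc r)) (range 0 t)) ⟨
    parity (count γ col (wrap s r t))                                 ≡⟨ odd ⟩
    1ℙ                                                                ∎)
    where
    open ≡-Reasoning
    x = parity (count γ col (range s (suc r)))
    0ℙ≢1ℙ : 0ℙ ≢ 1ℙ
    0ℙ≢1ℙ ()

  wrap-differs : ∀ {a b} → a < m → b < m → ¬ (∀ col → π a col ≡ π b col ℙ.+ π m col)
  wrap-differs {a} {b} a<m b<m same with a ≤? b
  ... | yes a≤b = wrap-separates b (m ∸ suc b) a (trans (+-suc b _) (m+[n∸m]≡n b<m)) a≤b same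
  ... | no  a≰b = wrap-separates a (m ∸ suc a) b (trans (+-suc a _) (m+[n∸m]≡n a<m)) (<⇒≤ (≰⇒> a≰b)) (ℙ-swap ∘ same)

  positions-agree : ∀ (a b : Fin m) → π (toℕ a) ≗ π (toℕ b) → a ≡ b
  positions-agree a b same with <-cmp (toℕ a) (toℕ b)
  ... | tri< a<b _ _ = ⊥-elim (prefixes-differ a<b (<⇒≤ (toℕ<n b)) same)
  ... | tri≈ _ a≡b _ = toℕ-injective a≡b
  ... | tri> _ _ b<a = ⊥-elim (prefixes-differ b<a (<⇒≤ (toℕ<n a)) (sym ∘ same))

  signature : Fin m ⊎ Fin m → Fin k → Parity
  signature (inj₁ a) col = π (toℕ a) col
  signature (inj₂ a) col = π (toℕ a) col ℙ.+ π m col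

  signature-injective : ∀ x y → signature x ≗ signature y → x ≡ y
  signature-injective (inj₁ a) (inj₁ b) same = cong inj₁ (positions-agree a b same)
  signature-injective (inj₂ a) (inj₂ b) same =
    cong inj₂ (positions-agree a b (λ col → ℙ.+-cancelʳ-≡ (π m col) _ _ (same col)))
  signature-injective (inj₁ a) (inj₂ b) same = ⊥-elim (wrap-differs (toℕ<n a) (toℕ<n b) same)
  signature-injective (inj₂ a) (inj₁ b) same = ⊥-elim (wrap-differs (toℕ<n b) (toℕ<n a) (sym ∘ same))

  twice-m≤2^k : 2 * m ≤ 2 ^ k
  twice-m≤2^k = subst (_≤ 2 ^ k) (cong (m +_) (sym (+-identityʳ m)))
    (distinct-parity-vectors (signature ∘ splitAt m) λ i j same →
      splitAt-injective (signature-injective (splitAt m i) (splitAt m j) same))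
    where
    splitAt-injective : ∀ {i j} → splitAt m {m} i ≡ splitAt m j → i ≡ j
    splitAt-injective {i} {j} e =
      trans (sym (join-splitAt m m i)) (trans (cong (Fin.join m m) e) (join-splitAt m m j))

n≤2^⌈log₂n⌉ : ∀ n → n ≤ 2 ^ ⌈log₂ n ⌉
n≤2^⌈log₂n⌉ = <-rec (λ n → n ≤ 2 ^ ⌈log₂ n ⌉) step
  where
  step : ∀ n → (∀ {h} → h < n → h ≤ 2 ^ ⌈log₂ h ⌉) → n ≤ 2 ^ ⌈log₂ n ⌉
  step zero            _  = z≤n
  step (suc zero)      _  = s≤s z≤n
  step n@(suc (suc i)) ih = begin
    n                        ≤⟨ n≤2*⌈n/2⌉ ⟩
    2 * ⌈ n /2⌉              ≤⟨ *-monoʳ-≤ 2 (subst (λ e → ⌈ n /2⌉ ≤ 2 ^ e) (⌈log₂⌈n/2⌉⌉≡⌈log₂n⌉∸1 n) (ih (⌈n/2⌉<n i))) ⟩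
    2 * 2 ^ (⌈log₂ n ⌉ ∸ 1)  ≡⟨ cong (2 ^_) (m+[n∸m]≡n 1≤⌈log₂n⌉) ⟩
    2 ^ ⌈log₂ n ⌉            ∎
    where
    open ≤-Reasoning
    n≤2*⌈n/2⌉ : n ≤ 2 * ⌈ n /2⌉
    n≤2*⌈n/2⌉ = subst₂ _≤_ (⌊n/2⌋+⌈n/2⌉≡n n) (cong (⌈ n /2⌉ +_) (sym (+-identityʳ ⌈ n /2⌉)))
                       (+-monoˡ-≤ ⌈ n /2⌉ (⌊n/2⌋≤⌈n/2⌉ n))
    1≤⌈log₂n⌉ : 1 ≤ ⌈log₂ n ⌉
    1≤⌈log₂n⌉ = ⌈log₂⌉-mono-≤ {2} {n} (s≤s (s≤s z≤n))

⌈log₂n⌉+1≤ : ∀ {n k} → 1 ≤ n → 2 * n ≤ 2 ^ k → ⌈log₂ n ⌉ + 1 ≤ k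
⌈log₂n⌉+1≤ {suc n} {k} _ 2n≤2^k = begin
  ⌈log₂ suc n ⌉ + 1    ≡⟨ +-comm _ 1 ⟩
  1 + ⌈log₂ suc n ⌉    ≡⟨ ⌈log₂2*n⌉≡1+⌈log₂n⌉ (suc n) ⟨
  ⌈log₂ (2 * suc n) ⌉  ≤⟨ ⌈log₂⌉-mono-≤ 2n≤2^k ⟩
  ⌈log₂ (2 ^ k) ⌉      ≡⟨ ⌈log₂2^n⌉≡n k ⟩
  k                    ∎
  where open ≤-Reasoning

lemma2 : (n : ℕ) (h : 3 ≤ n) →
    IsParityChromaticNumber (Cycle n h) (⌈log₂ n ⌉ + 1)
lemma2 n h =
  parity-colouring h ⌈log₂ n ⌉ (n≤2^⌈log₂n⌉ n) ,
  λ k c isParity → ⌈log₂n⌉+1≤ (≤-trans (s≤s z≤n) h) (LowerBound.twice-m≤2^k h c isParity)
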